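{- Every fullerene graph $F$ on $n$ vertices satisfies $$ s(F)\ge \frac{n}{3}-2. $$
   Context: A fullerene graph is a 3-connected, 3-regular planar graph all of whose faces (in its plane embedding) are pentagons or hexagons (by Euler's formula there are exactly twelve pentagonal faces). A matching of a graph $G$ is a set of pairwise disjoint edges; it is maximal if no edge of $G$ can be added to it while keeping it a matching. The saturation number $s(G)$ is the minimum cardinality of a maximal matching of $G$. -}

module Defs where

open import Data.Nat using (ℕ; zero; suc; _+_; _*_; _≤_; _<_; _≤ᵇ_)
open import Data.Fin using (Fin; toℕ) renaming (zero to fz; suc to fs)
open import Data.List using (List; length; upTo; filterᵇ; _∷_; []; cartesianProduct; allFin)
open import Data.List.Relation.Unary.All using (All)
open import Data.List.Relation.Unary.Any using (Any)
open import Data.List.Relation.Unary.AllPairs using (AllPairs)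
open import Data.Product using (_×_; _,_; proj₁; proj₂; ∃)
open import Data.Sum using (_⊎_)
open import Data.Unit using (⊤)
import Data.Bool
open import Relation.Binary.PropositionalEquality using (_≡_; _≢_)

-- A cubic (3-regular) simple graph on vertex set Fin n, given together with a
-- rotation system: nbr v i (i : Fin 3) lists the three neighbours of v in the
-- cyclic order of a combinatorial embedding.  back v i is the position of v in
-- the neighbour list of nbr v i (determined by the other fields).
record Cubic (n : ℕ) : Set where
  field
    nbr      : Fin n → Fin 3 → Fin n
    back     : Fin n → Fin 3 → Fin 3
    loopless : ∀ v i → nbr v i ≢ v
    nbr-inj  : ∀ v i j → nbr v i ≡ nbr v j → i ≡ j
    back-ok  : ∀ v i → nbr (nbr v i) (back v i) ≡ v
open Cubic public

module _ {n : ℕ} (G : Cubic n) where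

  Adj : Fin n → Fin n → Set
  Adj u w = ∃ λ i → nbr G u i ≡ w

  data Walk (P : Fin n → Set) : Fin n → Fin n → Set where
    here : ∀ {u} → P u → Walk P u u
    step : ∀ {u v w} → P u → Adj u v → Walk P v w → Walk P u w

  Connected : Set
  Connected = ∀ u v → Walk (λ _ → ⊤) u v

  -- 3-connected: more than 3 vertices, and deleting any set of at most two
  -- vertices {a, b} (a = b allowed) leaves a connected graph.
  ThreeConnected : Set
  ThreeConnected =
    4 ≤ n × Connected ×
    (∀ (a b u v : Fin n) → u ≢ a → u ≢ b → v ≢ a → v ≢ b →
       Walk (λ x → x ≢ a × x ≢ b) u v)

allᵇ : {A : Set} → (A → Data.Bool.Bool) → List A → Data.Bool.Bool
allᵇ p [] = Data.Bool.true
allᵇ p (x ∷ xs) = p x Data.Bool.∧ allᵇ p xs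

-- darts (directed edges) of the rotation system
Dart : ℕ → Set
Dart n = Fin n × Fin 3

next3 : Fin 3 → Fin 3
next3 fz = fs fz
next3 (fs fz) = fs (fs fz)
next3 (fs (fs fz)) = fz

iter : {A : Set} → ℕ → (A → A) → A → A
iter zero f x = x
iter (suc k) f x = f (iter k f x)

module _ {n : ℕ} (G : Cubic n) where

  -- face permutation phi = sigma ∘ alpha: traverse dart (v,i) to w = nbr v i,
  -- then rotate at w.  Faces of the embedding = orbits of faceStep.
  faceStep : Dart n → Dart n
  faceStep (v , i) = nbr G v i , next3 (back G v i)

  key : Dart n → ℕ
  key (v , i) = 3 * toℕ v + toℕ i

  allDarts : List (Dart n)
  allDarts = cartesianProduct (allFin n) (allFin 3)

  -- a dart is the representative of its face iff it has minimal key in its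
  -- orbit (orbits have size ≤ 3n)
  isFaceRep : Dart n → Data.Bool.Bool
  isFaceRep d = allᵇ (λ k → key d ≤ᵇ key (iter k faceStep d)) (upTo (3 * n))

  faceCount : ℕ
  faceCount = length (filterᵇ isFaceRep allDarts)

  FaceSize : Dart n → ℕ → Set
  FaceSize d m = iter m faceStep d ≡ d ×
                 (∀ k → 1 ≤ k → k < m → iter k faceStep d ≢ d)

  -- the rotation system is a plane (sphere) embedding: connected and
  -- Euler's formula V - E + F = 2 with E = 3n/2, i.e. 2V + 2F = 2E + 4
  Spherical : Set
  Spherical = Connected G × 2 * n + 2 * faceCount ≡ 3 * n + 4

  PentHexFaces : Set
  PentHexFaces = ∀ d → FaceSize d 5 ⊎ FaceSize d 6

  Fullerene : Set
  Fullerene = ThreeConnected G × Spherical × PentHexFaces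

  Edge : Set
  Edge = Fin n × Fin n

  Disjoint : Edge → Edge → Set
  Disjoint e f = proj₁ e ≢ proj₁ f × proj₁ e ≢ proj₂ f ×
                 proj₂ e ≢ proj₁ f × proj₂ e ≢ proj₂ f

  IsMatching : List Edge → Set
  IsMatching M = All (λ e → Adj G (proj₁ e) (proj₂ e)) M × AllPairs Disjoint M

  Covered : List Edge → Fin n → Set
  Covered M v = Any (λ e → proj₁ e ≡ v ⊎ proj₂ e ≡ v) M

  IsMaximalMatching : List Edge → Set
  IsMaximalMatching M =
    IsMatching M × (∀ u w → Adj G u w → Covered M u ⊎ Covered M w)

-- Let M be a maximal matching; its covered ("matched") vertices number at most
-- 2|M|, and every neighbour of an unmatched vertex is matched.  Ask 5 units of every unmatched
-- and 2 units of every matched vertex, and let each vertex pay its three corners by a local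
-- rule that only looks at where the matched edges near the corner lie.  A finite check shows
-- that every vertex pays at least what is asked, while every pentagon and hexagon receives at
-- most 6.  With u unmatched and c matched vertices and F faces, Euler's formula 2F = n + 4
-- gives 5u + 2c ≤ 6F = 3(u + c) + 12, i.e. 2n ≤ 3c + 12 ≤ 6|M| + 12.
module Submission where

open import Defs
open import Data.Bool using (Bool; true; false; _∧_; if_then_else_; T; T?)
open import Data.Bool.Properties using (T-≡; T-∧)
open import Data.Empty using (⊥; ⊥-elim)
open import Data.Fin using (Fin; _≟_) renaming (zero to fz; suc to fs)
open import Data.Fin.Properties using () renaming (any? to anyFin?)
open import Data.List as List using (List; []; _∷_; _++_; map; take; length; filterᵇ; cartesianProduct; allFin; upTo; applyUpTo; iterate)
open import Data.List.Extrema.Nat using (argmin; argmin-all; f[argmin]≤f[xs])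
open import Data.List.Membership.Propositional using (_∈_; find)
open import Data.List.Membership.Propositional.Properties using (∈-map⁺; ∈-cartesianProduct⁺; ∈-allFin; ∈-upTo⁺; ∈-applyUpTo⁺)
open import Data.List.Membership.Propositional.Properties.WithK using (unique∧set⇒bag)
open import Data.List.Properties using (map-cong; map-cong-local; map-∘; map-++; map-applyUpTo; upTo-∷ʳ; length-tabulate)
open import Data.List.Relation.Binary.BagAndSetEquality using (∼bag⇒↭)
import Data.List.Relation.Binary.Permutation.Propositional.Properties as ↭
open import Data.List.Relation.Unary.All using (All; []; _∷_)
import Data.List.Relation.Unary.All as All
open import Data.List.Relation.Unary.All.Properties using (all-upTo; applyUpTo⁺₁)
open import Data.List.Relation.Unary.AllPairs using (AllPairs; []; _∷_)
open import Data.List.Relation.Unary.Any using (Any; here; there; any?)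
import Data.List.Relation.Unary.Any as Any
open import Data.List.Relation.Unary.Unique.Propositional using (Unique)
import Data.List.Relation.Unary.Unique.Propositional.Properties as Unique
open import Data.Maybe using (Maybe; just; nothing; is-just)
open import Data.Nat using (ℕ; zero; suc; _+_; _*_; _∸_; _≤_; _<_; z≤n; s≤s; z<s; _<?_; _≤?_; _≤ᵇ_)
open import Data.Nat.ListAction using (sum)
open import Data.Nat.ListAction.Properties using (sum-↭)
open import Data.Nat.Properties hiding (_≟_)
open import Algebra.Properties.CommutativeSemigroup +-commutativeSemigroup using () renaming (interchange to +-interchange)
open import Data.Nat.Tactic.RingSolver using (solve)
open import Data.Product using (_×_; _,_; proj₁; proj₂; ∃)
open import Data.Sum using (_⊎_; inj₁; inj₂)
import Data.Sum as Sum
open import Data.Unit using (tt)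
open import Function using (_∘_; id)
open import Function.Bundles using (_⇔_; mk⇔; Equivalence)
import Function.Properties.Equivalence as ⇔
open import Relation.Binary using (tri<; tri≈; tri>)
open import Relation.Binary.PropositionalEquality
open import Relation.Nullary using (Dec; ¬_; yes; no)
open import Relation.Nullary.Decidable using (does; toWitness; map′; _×-dec_; _⊎-dec_; _→-dec_; dec-true; dec-false)

∑ : {A : Set} → (A → ℕ) → List A → ℕ
∑ f xs = sum (map f xs)

𝟙 : Bool → ℕ
𝟙 true = 1
𝟙 false = 0

module _ {A : Set} where

  ∑-cong : {f g : A → ℕ} → (∀ x → f x ≡ g x) → ∀ xs → ∑ f xs ≡ ∑ g xs
  ∑-cong f≗g xs = cong sum (map-cong f≗g xs)

  ∑-cong-local : {f g : A → ℕ} {xs : List A} → All (λ x → f x ≡ g x) xs → ∑ f xs ≡ ∑ g xs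
  ∑-cong-local f≗g = cong sum (map-cong-local f≗g)

  ∑-mono-≤ : {f g : A → ℕ} → (∀ x → f x ≤ g x) → ∀ xs → ∑ f xs ≤ ∑ g xs
  ∑-mono-≤ f≤g [] = z≤n
  ∑-mono-≤ f≤g (x ∷ xs) = +-mono-≤ (f≤g x) (∑-mono-≤ f≤g xs)

  ∑-+ : (f g : A → ℕ) → ∀ xs → ∑ (λ x → f x + g x) xs ≡ ∑ f xs + ∑ g xs
  ∑-+ f g [] = refl
  ∑-+ f g (x ∷ xs) = trans (cong (f x + g x +_) (∑-+ f g xs)) (+-interchange (f x) (g x) _ _)

  ∑-*ˡ : ∀ k (f : A → ℕ) xs → ∑ (λ x → k * f x) xs ≡ k * ∑ f xs
  ∑-*ˡ k f [] = sym (*-zeroʳ k)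
  ∑-*ˡ k f (x ∷ xs) = trans (cong (k * f x +_) (∑-*ˡ k f xs)) (sym (*-distribˡ-+ k (f x) (∑ f xs)))

  ∑-const : ∀ k (xs : List A) → ∑ (λ _ → k) xs ≡ k * length xs
  ∑-const k [] = sym (*-zeroʳ k)
  ∑-const k (x ∷ xs) = trans (cong (k +_) (∑-const k xs)) (sym (*-suc k (length xs)))

  ∑-++ : (f : A → ℕ) → ∀ xs ys → ∑ f (xs ++ ys) ≡ ∑ f xs + ∑ f ys
  ∑-++ f [] ys = refl
  ∑-++ f (x ∷ xs) ys = trans (cong (f x +_) (∑-++ f xs ys)) (sym (+-assoc (f x) _ _))

  ∈⇒≤∑ : (f : A → ℕ) → ∀ {x xs} → x ∈ xs → f x ≤ ∑ f xs
  ∈⇒≤∑ f {xs = y ∷ ys} (here refl) = m≤m+n (f y) (∑ f ys)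
  ∈⇒≤∑ f {xs = y ∷ ys} (there x∈ys) = ≤-trans (∈⇒≤∑ f x∈ys) (m≤n+m (∑ f ys) (f y))

  ∑-bijection : ∀ {xs} → Unique xs → (∀ x → x ∈ xs) →
    (π π⁻¹ : A → A) → (∀ x → π⁻¹ (π x) ≡ x) → (∀ x → π (π⁻¹ x) ≡ x) →
    (f : A → ℕ) → ∑ (f ∘ π) xs ≡ ∑ f xs
  ∑-bijection {xs} unique complete π π⁻¹ π⁻¹∘π π∘π⁻¹ f =
    trans (cong sum (map-∘ xs)) (sum-↭ (↭.map⁺ f (∼bag⇒↭ (unique∧set⇒bag (Unique.map⁺ π-injective unique) unique
      (λ {x} → mk⇔ (λ _ → complete x) (λ _ → subst (_∈ map π xs) (π∘π⁻¹ x) (∈-map⁺ π (complete (π⁻¹ x)))))))))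
    where
    π-injective : ∀ {x y} → π x ≡ π y → x ≡ y
    π-injective {x} {y} e = trans (sym (π⁻¹∘π x)) (trans (cong π⁻¹ e) (π⁻¹∘π y))

  length-filterᵇ : (p : A → Bool) → ∀ xs → length (filterᵇ p xs) ≡ ∑ (𝟙 ∘ p) xs
  length-filterᵇ p [] = refl
  length-filterᵇ p (x ∷ xs) with p x
  ... | true = cong suc (length-filterᵇ p xs)
  ... | false = length-filterᵇ p xs

∑-map : {A B : Set} (f : B → ℕ) (g : A → B) → ∀ xs → ∑ f (map g xs) ≡ ∑ (f ∘ g) xs
∑-map f g xs = cong sum (sym (map-∘ xs))

∑-cartesianProduct : {A B : Set} (f : A × B → ℕ) → ∀ xs ys →
  ∑ f (cartesianProduct xs ys) ≡ ∑ (λ x → ∑ (λ y → f (x , y)) ys) xs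
∑-cartesianProduct f [] ys = refl
∑-cartesianProduct f (x ∷ xs) ys =
  trans (∑-++ f (map (x ,_) ys) _) (cong₂ _+_ (∑-map f (x ,_) ys) (∑-cartesianProduct f xs ys))

∑-swap : {A B : Set} (f : A → B → ℕ) → ∀ xs ys →
  ∑ (λ x → ∑ (f x) ys) xs ≡ ∑ (λ y → ∑ (λ x → f x y) xs) ys
∑-swap f [] ys = sym (∑-const 0 ys)
∑-swap f (x ∷ xs) ys = trans (cong (∑ (f x) ys +_) (∑-swap f xs ys)) (sym (∑-+ (f x) _ ys))

below : ℕ → (ℕ → ℕ) → ℕ → ℕ
below s g k = if does (k <? s) then g k else 0

below-< : ∀ {s k} g → k < s → below s g k ≡ g k
below-< {s} {k} g k<s rewrite dec-true (k <? s) k<s = refl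

below-≥ : ∀ {s k} g → s ≤ k → below s g k ≡ 0
below-≥ {s} {k} g s≤k rewrite dec-false (k <? s) (≤⇒≯ s≤k) = refl

∑-below : ∀ g {s} L → s ≤ L → ∑ (below s g) (upTo L) ≡ ∑ g (upTo s)
∑-below g zero z≤n = refl
∑-below g {s} (suc L) s≤1+L with m≤n⇒m<n∨m≡n s≤1+L
... | inj₂ refl = ∑-cong-local (All.map (below-< g) (all-upTo s))
... | inj₁ s<1+L = begin
  ∑ (below s g) (upTo (suc L))               ≡⟨ cong (∑ (below s g)) (upTo-∷ʳ L) ⟨
  ∑ (below s g) (upTo L ++ L ∷ [])           ≡⟨ ∑-++ (below s g) (upTo L) (L ∷ []) ⟩
  ∑ (below s g) (upTo L) + (below s g L + 0) ≡⟨ cong (λ x → ∑ (below s g) (upTo L) + (x + 0)) (below-≥ g (≤-pred s<1+L)) ⟩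
  ∑ (below s g) (upTo L) + 0                 ≡⟨ +-identityʳ _ ⟩
  ∑ (below s g) (upTo L)                     ≡⟨ ∑-below g L (≤-pred s<1+L) ⟩
  ∑ g (upTo s)                               ∎
  where open ≡-Reasoning

∑-𝟙-≟ : ∀ {n} (a : Fin n) {xs} → Unique xs → ∑ (λ x → 𝟙 (does (a ≟ x))) xs ≤ 1
∑-𝟙-≟ a [] = z≤n
∑-𝟙-≟ a {x ∷ xs} (x∉xs ∷ unique) with a ≟ x
... | no _ = ∑-𝟙-≟ a unique
... | yes refl = ≤-reflexive (cong suc (trans (∑-cong-local (All.map (cong 𝟙 ∘ dec-false (a ≟ _)) x∉xs)) (∑-const 0 xs)))

iter-comm : {A : Set} (f : A → A) → ∀ k x → iter k f (f x) ≡ f (iter k f x)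
iter-comm f zero x = refl
iter-comm f (suc k) x = cong f (iter-comm f k x)

iter-+ : {A : Set} (f : A → A) → ∀ a b x → iter (a + b) f x ≡ iter a f (iter b f x)
iter-+ f zero b x = refl
iter-+ f (suc a) b x = cong f (iter-+ f a b x)

iterate-+ : {A : Set} (f : A → A) → ∀ m k x → iterate f x (m + k) ≡ iterate f x m ++ iterate f (iter m f x) k
iterate-+ f zero k x = refl
iterate-+ f (suc m) k x =
  cong (x ∷_) (trans (iterate-+ f m k (f x)) (cong (λ y → iterate f (f x) m ++ iterate f y k) (iter-comm f m x)))

iterate≡map-iter : {A : Set} (f : A → A) → ∀ m x → iterate f x m ≡ map (λ k → iter k f x) (upTo m)
iterate≡map-iter f zero x = refl
iterate≡map-iter f (suc m) x = cong (x ∷_) (begin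
  iterate f (f x) m                         ≡⟨ iterate≡map-iter f m (f x) ⟩
  map (λ k → iter k f (f x)) (upTo m)       ≡⟨ map-cong (λ k → iter-comm f k x) (upTo m) ⟩
  map (λ k → iter (suc k) f x) (upTo m)     ≡⟨ map-∘ (upTo m) ⟩
  map (λ k → iter k f x) (map suc (upTo m)) ≡⟨ cong (map (λ k → iter k f x)) (map-applyUpTo id suc m) ⟩
  map (λ k → iter k f x) (applyUpTo suc m)  ∎)
  where open ≡-Reasoning

-- Darts and faces of a cubic rotation system

prev3 : Fin 3 → Fin 3
prev3 fz = fs (fs fz)
prev3 (fs fz) = fz
prev3 (fs (fs fz)) = fs fz

prev3-next3 : ∀ i → prev3 (next3 i) ≡ i
prev3-next3 fz = refl
prev3-next3 (fs fz) = refl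
prev3-next3 (fs (fs fz)) = refl

next3-prev3 : ∀ i → next3 (prev3 i) ≡ i
next3-prev3 fz = refl
next3-prev3 (fs fz) = refl
next3-prev3 (fs (fs fz)) = refl

allᵇ-true : {A : Set} (p : A → Bool) → (∀ x → p x ≡ true) → ∀ xs → allᵇ p xs ≡ true
allᵇ-true p p≡true [] = refl
allᵇ-true p p≡true (x ∷ xs) rewrite p≡true x = allᵇ-true p p≡true xs

module Darts {n : ℕ} (G : Cubic n) where

  φ : Dart n → Dart n
  φ = faceStep G

  reverse : Dart n → Dart n
  reverse (v , i) = nbr G v i , back G v i

  -- φ d reduces to rotate (reverse d)
  rotate : Dart n → Dart n
  rotate (v , i) = v , next3 i

  φ⁻¹ : Dart n → Dart n
  φ⁻¹ (v , i) = reverse (v , prev3 i)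

  back-back : ∀ v i → back G (nbr G v i) (back G v i) ≡ i
  back-back v i = nbr-inj G v _ i
    (subst (λ u → nbr G u (back G (nbr G v i) (back G v i)) ≡ nbr G v i) (back-ok G v i) (back-ok G _ _))

  reverse-involutive : ∀ d → reverse (reverse d) ≡ d
  reverse-involutive (v , i) = cong₂ _,_ (back-ok G v i) (back-back v i)

  φ-reverse : ∀ d → φ (reverse d) ≡ rotate d
  φ-reverse d = cong rotate (reverse-involutive d)

  φ⁻¹-φ : ∀ d → φ⁻¹ (φ d) ≡ d
  φ⁻¹-φ (v , i) rewrite prev3-next3 (back G v i) = reverse-involutive (v , i)

  φ-φ⁻¹ : ∀ d → φ (φ⁻¹ d) ≡ d
  φ-φ⁻¹ (v , i) = trans (φ-reverse (v , prev3 i)) (cong (v ,_) (next3-prev3 i))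

  φ-injective : ∀ {d e} → φ d ≡ φ e → d ≡ e
  φ-injective {d} {e} φd≡φe = trans (sym (φ⁻¹-φ d)) (trans (cong φ⁻¹ φd≡φe) (φ⁻¹-φ e))

  iter-φ-φ⁻¹ : ∀ k d → iter k φ (iter k φ⁻¹ d) ≡ d
  iter-φ-φ⁻¹ zero d = refl
  iter-φ-φ⁻¹ (suc k) d = begin
    φ (iter k φ (φ⁻¹ (iter k φ⁻¹ d))) ≡⟨ cong (λ e → φ (iter k φ e)) (iter-comm φ⁻¹ k d) ⟨
    φ (iter k φ (iter k φ⁻¹ (φ⁻¹ d))) ≡⟨ cong φ (iter-φ-φ⁻¹ k (φ⁻¹ d)) ⟩
    φ (φ⁻¹ d)                         ≡⟨ φ-φ⁻¹ d ⟩
    d                                 ∎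
    where open ≡-Reasoning

  iter-φ⁻¹-φ : ∀ k d → iter k φ⁻¹ (iter k φ d) ≡ d
  iter-φ⁻¹-φ zero d = refl
  iter-φ⁻¹-φ (suc k) d = begin
    φ⁻¹ (iter k φ⁻¹ (φ (iter k φ d))) ≡⟨ cong (λ e → φ⁻¹ (iter k φ⁻¹ e)) (iter-comm φ k d) ⟨
    φ⁻¹ (iter k φ⁻¹ (iter k φ (φ d))) ≡⟨ cong φ⁻¹ (iter-φ⁻¹-φ k (φ d)) ⟩
    φ⁻¹ (φ d)                         ≡⟨ φ⁻¹-φ d ⟩
    d                                 ∎
    where open ≡-Reasoning

  allDarts-unique : Unique (allDarts G)
  allDarts-unique = Unique.cartesianProduct⁺ (Unique.allFin⁺ n) (Unique.allFin⁺ 3)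

  ∈-allDarts : ∀ d → d ∈ allDarts G
  ∈-allDarts (v , i) = ∈-cartesianProduct⁺ (∈-allFin v) (∈-allFin i)

  ∑-φ : (f : Dart n → ℕ) → ∑ (f ∘ φ) (allDarts G) ≡ ∑ f (allDarts G)
  ∑-φ = ∑-bijection allDarts-unique ∈-allDarts φ φ⁻¹ φ⁻¹-φ φ-φ⁻¹

  ∑-iter-φ⁻¹ : ∀ k (f : Dart n → ℕ) → ∑ (f ∘ iter k φ⁻¹) (allDarts G) ≡ ∑ f (allDarts G)
  ∑-iter-φ⁻¹ k = ∑-bijection allDarts-unique ∈-allDarts (iter k φ⁻¹) (iter k φ) (iter-φ-φ⁻¹ k) (iter-φ⁻¹-φ k)

  FaceSize-φ : ∀ {d m} → FaceSize G d m → FaceSize G (φ d) m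
  FaceSize-φ {d} {m} (period , minimal) =
    trans (iter-comm φ m d) (cong φ period) ,
    λ k 1≤k k<m e → minimal k 1≤k k<m (φ-injective (trans (sym (iter-comm φ k d)) e))

  FaceSize-unique : ∀ {d m m′} → 0 < m → 0 < m′ → FaceSize G d m → FaceSize G d m′ → m ≡ m′
  FaceSize-unique {m = m} {m′} 0<m 0<m′ (period , minimal) (period′ , minimal′) with <-cmp m m′
  ... | tri< m<m′ _ _ = ⊥-elim (minimal′ m 0<m m<m′ period)
  ... | tri≈ _ m≡m′ _ = m≡m′
  ... | tri> _ _ m′<m = ⊥-elim (minimal m′ 0<m′ m′<m period′)

module FaceCounting {n : ℕ} (G : Cubic n) (size : Dart n → ℕ)
  (size-positive : ∀ d → 0 < size d) (isFaceSize : ∀ d → FaceSize G d (size d))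
  (L : ℕ) (size≤L : ∀ d → size d ≤ L) where

  open Darts G

  size-φ : ∀ d → size (φ d) ≡ size d
  size-φ d = FaceSize-unique (size-positive (φ d)) (size-positive d) (isFaceSize (φ d)) (FaceSize-φ (isFaceSize d))

  size-iter-φ⁻¹ : ∀ k d → size (iter k φ⁻¹ d) ≡ size d
  size-iter-φ⁻¹ zero d = refl
  size-iter-φ⁻¹ (suc k) d = begin
    size (φ⁻¹ (iter k φ⁻¹ d))     ≡⟨ size-φ (φ⁻¹ (iter k φ⁻¹ d)) ⟨
    size (φ (φ⁻¹ (iter k φ⁻¹ d))) ≡⟨ cong size (φ-φ⁻¹ (iter k φ⁻¹ d)) ⟩
    size (iter k φ⁻¹ d)           ≡⟨ size-iter-φ⁻¹ k d ⟩
    size d                        ∎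
    where open ≡-Reasoning

  iter-reduce : ∀ d t → ∃ λ r → r < size d × iter t φ d ≡ iter r φ d
  iter-reduce d zero = 0 , size-positive d , refl
  iter-reduce d (suc t) with iter-reduce d t
  ... | r , r<s , e with m≤n⇒m<n∨m≡n r<s
  ...   | inj₁ 1+r<s = suc r , 1+r<s , cong φ e
  ...   | inj₂ 1+r≡s = 0 , size-positive d , trans (cong φ e) (trans (cong (λ k → iter k φ d) 1+r≡s) (proj₁ (isFaceSize d)))

  -- the dart of least key on the face of d is its representative
  representative : ∀ d → ∃ λ k → k < size d × isFaceRep G (iter k φ d) ≡ true
  representative d = k , k<s , allᵇ-true _ (λ t → ≤⇒≤ᵇ≡true (least t)) (upTo (3 * n))
    where
    orbit = applyUpTo (λ k → iter k φ d) (size d)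
    minimum = argmin (key G) d orbit
    onOrbit : ∃ λ k → k < size d × minimum ≡ iter k φ d
    onOrbit = argmin-all (key G) {P = λ e → ∃ λ k → k < size d × e ≡ iter k φ d}
      (0 , size-positive d , refl) (applyUpTo⁺₁ _ (size d) (λ {k} k<s → k , k<s , refl))
    k = proj₁ onOrbit
    k<s = proj₁ (proj₂ onOrbit)
    ≤⇒≤ᵇ≡true : ∀ {a b} → a ≤ b → (a ≤ᵇ b) ≡ true
    ≤⇒≤ᵇ≡true a≤b = Equivalence.to T-≡ (≤⇒≤ᵇ a≤b)
    least : ∀ t → key G (iter k φ d) ≤ key G (iter t φ (iter k φ d))
    least t with iter-reduce d (t + k)
    ... | r , r<s , e = subst₂ (λ x y → key G x ≤ key G y) (proj₂ (proj₂ onOrbit)) (sym (trans (sym (iter-+ φ t k d)) e))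
                          (All.lookup (f[argmin]≤f[xs] {f = key G} d orbit) (∈-applyUpTo⁺ _ r<s))

  backward-representative : ∀ d → ∃ λ k → k < size d × isFaceRep G (iter k φ⁻¹ d) ≡ true
  backward-representative d with representative d
  ... | zero , _ , rep = 0 , size-positive d , rep
  ... | suc j , 1+j<s , rep = size d ∸ suc j , ∸-monoʳ-< z<s (<⇒≤ 1+j<s) , subst (λ e → isFaceRep G e ≡ true) forward≡backward rep
    where
    k = size d ∸ suc j
    forward≡backward : iter (suc j) φ d ≡ iter k φ⁻¹ d
    forward≡backward = begin
      iter (suc j) φ d                          ≡⟨ iter-φ⁻¹-φ k _ ⟨
      iter k φ⁻¹ (iter k φ (iter (suc j) φ d))  ≡⟨ cong (iter k φ⁻¹) (iter-+ φ k (suc j) d) ⟨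
      iter k φ⁻¹ (iter (k + suc j) φ d)         ≡⟨ cong (λ t → iter k φ⁻¹ (iter t φ d)) (m∸n+n≡m (<⇒≤ 1+j<s)) ⟩
      iter k φ⁻¹ (iter (size d) φ d)            ≡⟨ cong (iter k φ⁻¹) (proj₁ (isFaceSize d)) ⟩
      iter k φ⁻¹ d                              ∎
      where open ≡-Reasoning

  -- each dart is charged to the representative of its face, fewer than L steps behind it
  ∑-≤-faceCount : (Z : Dart n → ℕ) (K : ℕ) →
    (∀ r → isFaceRep G r ≡ true → ∑ Z (iterate φ r (size r)) ≤ K) →
    ∑ Z (allDarts G) ≤ K * faceCount G
  ∑-≤-faceCount Z K face≤K = begin
    ∑ Z D                                                   ≤⟨ ∑-mono-≤ charged D ⟩
    ∑ (λ d → ∑ (λ k → share k (iter k φ⁻¹ d)) (upTo L)) D   ≡⟨ ∑-swap (λ d k → share k (iter k φ⁻¹ d)) D (upTo L) ⟩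
    ∑ (λ k → ∑ (share k ∘ iter k φ⁻¹) D) (upTo L)           ≡⟨ ∑-cong (λ k → ∑-iter-φ⁻¹ k (share k)) (upTo L) ⟩
    ∑ (λ k → ∑ (share k) D) (upTo L)                        ≡⟨ ∑-swap (λ r k → share k r) D (upTo L) ⟨
    ∑ (λ r → ∑ (λ k → share k r) (upTo L)) D                ≤⟨ ∑-mono-≤ collected D ⟩
    ∑ (λ r → K * 𝟙 (isFaceRep G r)) D                        ≡⟨ ∑-*ˡ K (𝟙 ∘ isFaceRep G) D ⟩
    K * ∑ (𝟙 ∘ isFaceRep G) D                                ≡⟨ cong (K *_) (length-filterᵇ (isFaceRep G) D) ⟨
    K * faceCount G                                          ∎
    where
    open ≤-Reasoning
    D = allDarts G
    -- what the representative r receives from the dart k steps after it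
    share : ℕ → Dart n → ℕ
    share k r = if isFaceRep G r then below (size r) (λ k → Z (iter k φ r)) k else 0

    charged : ∀ d → Z d ≤ ∑ (λ k → share k (iter k φ⁻¹ d)) (upTo L)
    charged d with backward-representative d
    ... | k , k<s , rep = subst (_≤ ∑ (λ k → share k (iter k φ⁻¹ d)) (upTo L)) share≡Z
                            (∈⇒≤∑ (λ k → share k (iter k φ⁻¹ d)) (∈-upTo⁺ (≤-trans k<s (size≤L d))))
      where
      share≡Z : share k (iter k φ⁻¹ d) ≡ Z d
      share≡Z rewrite rep | size-iter-φ⁻¹ k d | dec-true (k <? size d) k<s = cong Z (iter-φ-φ⁻¹ k d)

    collected : ∀ r → ∑ (λ k → share k r) (upTo L) ≤ K * 𝟙 (isFaceRep G r)
    collected r with isFaceRep G r in rep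
    ... | false = ≤-reflexive (trans (∑-const 0 (upTo L)) (sym (*-zeroʳ K)))
    ... | true = begin
      ∑ (below (size r) (λ k → Z (iter k φ r))) (upTo L) ≡⟨ ∑-below _ L (size≤L r) ⟩
      ∑ (λ k → Z (iter k φ r)) (upTo (size r))          ≡⟨ ∑-map Z (λ k → iter k φ r) (upTo (size r)) ⟨
      ∑ Z (map (λ k → iter k φ r) (upTo (size r)))      ≡⟨ cong (∑ Z) (iterate≡map-iter φ (size r) r) ⟨
      ∑ Z (iterate φ r (size r))                        ≤⟨ face≤K r rep ⟩
      K                                                 ≡⟨ *-identityʳ K ⟨
      K * 1                                             ∎

-- Corner labels and the local tables

-- The corner (v , i) of a face is entered along edge prev3 i and left along edge i.  Its label
-- says where the matched edge at v lies: U (v unmatched), P (on the entering edge),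
-- N (on the leaving edge) or O (on the third edge, outside the face).
data Label : Set where
  U P N O : Label

label : Maybe (Fin 3) → Fin 3 → Label
label nothing _ = U
label (just fz) fz = N
label (just fz) (fs fz) = P
label (just fz) (fs (fs fz)) = O
label (just (fs fz)) fz = O
label (just (fs fz)) (fs fz) = N
label (just (fs fz)) (fs (fs fz)) = P
label (just (fs (fs fz))) fz = P
label (just (fs (fs fz))) (fs fz) = O
label (just (fs (fs fz))) (fs (fs fz)) = N

turn : Label → Label
turn U = U
turn P = O
turn N = P
turn O = N

label-next3 : ∀ x i → label x (next3 i) ≡ turn (label x i)
label-next3 nothing i = refl
label-next3 (just fz) fz = refl
label-next3 (just fz) (fs fz) = refl
label-next3 (just fz) (fs (fs fz)) = refl
label-next3 (just (fs fz)) fz = refl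
label-next3 (just (fs fz)) (fs fz) = refl
label-next3 (just (fs fz)) (fs (fs fz)) = refl
label-next3 (just (fs (fs fz))) fz = refl
label-next3 (just (fs (fs fz))) (fs fz) = refl
label-next3 (just (fs (fs fz))) (fs (fs fz)) = refl

label≡N⇔ : ∀ x i → label x i ≡ N ⇔ x ≡ just i
label≡N⇔ x i = mk⇔ (to x i) λ { refl → from i }
  where
  to : ∀ x i → label x i ≡ N → x ≡ just i
  to (just fz) fz _ = refl
  to (just (fs fz)) (fs fz) _ = refl
  to (just (fs (fs fz))) (fs (fs fz)) _ = refl
  to nothing _ ()
  to (just fz) (fs fz) ()
  to (just fz) (fs (fs fz)) ()
  to (just (fs fz)) fz ()
  to (just (fs fz)) (fs (fs fz)) ()
  to (just (fs (fs fz))) fz ()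
  to (just (fs (fs fz))) (fs fz) ()
  from : ∀ i → label (just i) i ≡ N
  from fz = refl
  from (fs fz) = refl
  from (fs (fs fz)) = refl

label≡U⇒nothing : ∀ x i → label x i ≡ U → x ≡ nothing
label≡U⇒nothing nothing _ _ = refl
label≡U⇒nothing (just fz) fz ()
label≡U⇒nothing (just fz) (fs fz) ()
label≡U⇒nothing (just fz) (fs (fs fz)) ()
label≡U⇒nothing (just (fs fz)) fz ()
label≡U⇒nothing (just (fs fz)) (fs fz) ()
label≡U⇒nothing (just (fs fz)) (fs (fs fz)) ()
label≡U⇒nothing (just (fs (fs fz))) fz ()
label≡U⇒nothing (just (fs (fs fz))) (fs fz) ()
label≡U⇒nothing (just (fs (fs fz))) (fs (fs fz)) ()

-- whether a, b can label consecutive corners of a face, i.e. the two ends of a face edge: the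
-- edge is matched at one end (N) iff at the other (P), and maximality forbids two unmatched ends
valid : Label → Label → Bool
valid N P = true
valid N _ = false
valid _ P = false
valid U U = false
valid _ _ = true

valid-turn : ∀ a c → (a ≡ N ⇔ c ≡ N) → ¬ (a ≡ U × c ≡ U) → T (valid a (turn c))
valid-turn N N _ _ = tt
valid-turn N U a⇔c _ with () ← Equivalence.to a⇔c refl
valid-turn N P a⇔c _ with () ← Equivalence.to a⇔c refl
valid-turn N O a⇔c _ with () ← Equivalence.to a⇔c refl
valid-turn U N a⇔c _ with () ← Equivalence.from a⇔c refl
valid-turn P N a⇔c _ with () ← Equivalence.from a⇔c refl
valid-turn O N a⇔c _ with () ← Equivalence.from a⇔c refl
valid-turn U U _ ¬UU = ⊥-elim (¬UU (refl , refl))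
valid-turn U P _ _ = tt
valid-turn U O _ _ = tt
valid-turn P U _ _ = tt
valid-turn P P _ _ = tt
valid-turn P O _ _ = tt
valid-turn O U _ _ = tt
valid-turn O P _ _ = tt
valid-turn O O _ _ = tt

-- the discharging rule: the charge a corner labelled b receives from its vertex, given the
-- labels a and c of the previous and next corner of its face
charge : Label → Label → Label → ℕ
charge P U _ = 2
charge _ U N = 2
charge _ U _ = 1
charge _ P O = 0
charge _ P U = 0
charge _ P _ = 1
charge _ N _ = 1
charge O O _ = 0
charge _ O _ = 1

demand : Label → ℕ
demand U = 5
demand _ = 2

validPath : List Label → Bool
validPath (a ∷ b ∷ cs) = valid a b ∧ validPath (b ∷ cs)
validPath _ = true

pathCharge : List Label → ℕ
pathCharge (a ∷ b ∷ c ∷ cs) = charge a b c + pathCharge (b ∷ c ∷ cs)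
pathCharge _ = 0

-- unrolls a cyclic sequence so that its consecutive triples are exactly those of the cycle
close : List Label → List Label
close xs = xs ++ take 2 xs

∀-Label? : {Q : Label → Set} → (∀ l → Dec (Q l)) → Dec (∀ l → Q l)
∀-Label? Q? = map′ (λ { (u , p , n , o) → λ { U → u ; P → p ; N → n ; O → o } })
                   (λ q → q U , q P , q N , q O)
                   (Q? U ×-dec Q? P ×-dec Q? N ×-dec Q? O)

-- ℓ labels the corner (v , 0), and tⱼ the corner at the j-th neighbour of v that is left along
-- the edge back to v
vertexTable : ∀ ℓ t₀ t₁ t₂ → T (valid t₀ (turn ℓ)) → T (valid t₁ (turn (turn ℓ))) → T (valid t₂ ℓ) →
  demand ℓ ≤ charge t₂ ℓ (turn t₀) + (charge t₀ (turn ℓ) (turn t₁) + charge t₁ (turn (turn ℓ)) (turn t₂))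
vertexTable = toWitness {a? = ∀-Label? λ ℓ → ∀-Label? λ t₀ → ∀-Label? λ t₁ → ∀-Label? λ t₂ →
  T? _ →-dec T? _ →-dec T? _ →-dec _ ≤? _} tt

FaceBound : List Label → Set
FaceBound xs = T (validPath (close xs)) → pathCharge (close xs) ≤ 6

pentagonTable : ∀ a b c d e → FaceBound (a ∷ b ∷ c ∷ d ∷ e ∷ [])
pentagonTable = toWitness {a? = ∀-Label? λ a → ∀-Label? λ b → ∀-Label? λ c → ∀-Label? λ d → ∀-Label? λ e →
  T? _ →-dec _ ≤? 6} tt

hexagonTable : ∀ a b c d e f → FaceBound (a ∷ b ∷ c ∷ d ∷ e ∷ f ∷ [])
hexagonTable = toWitness {a? = ∀-Label? λ a → ∀-Label? λ b → ∀-Label? λ c → ∀-Label? λ d → ∀-Label? λ e →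
  ∀-Label? λ f → T? _ →-dec _ ≤? 6} tt

module LabelledOrbit {A : Set} (f : A → A) (lab : A → Label) (valid-step : ∀ x → T (valid (lab x) (lab (f x)))) where

  chargeAfter : A → ℕ
  chargeAfter x = charge (lab x) (lab (f x)) (lab (f (f x)))

  pathCharge-iterate : ∀ m x → pathCharge (map lab (iterate f x (2 + m))) ≡ ∑ chargeAfter (iterate f x m)
  pathCharge-iterate zero x = refl
  pathCharge-iterate (suc m) x = cong (chargeAfter x +_) (pathCharge-iterate m (f x))

  validPath-iterate : ∀ m x → T (validPath (map lab (iterate f x m)))
  validPath-iterate zero x = tt
  validPath-iterate (suc zero) x = tt
  validPath-iterate (suc (suc m)) x = Equivalence.from T-∧ (valid-step x , validPath-iterate (suc m) (f x))

  close-iterate : ∀ {m x} → 2 ≤ m → iter m f x ≡ x → close (map lab (iterate f x m)) ≡ map lab (iterate f x (m + 2))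
  close-iterate {m@(suc (suc _))} {x} (s≤s (s≤s _)) period = begin
    map lab (iterate f x m) ++ map lab (iterate f x 2)       ≡⟨ map-++ lab (iterate f x m) _ ⟨
    map lab (iterate f x m ++ iterate f x 2)                 ≡⟨ cong (λ y → map lab (iterate f x m ++ iterate f y 2)) period ⟨
    map lab (iterate f x m ++ iterate f (iter m f x) 2)      ≡⟨ cong (map lab) (iterate-+ f m 2 x) ⟨
    map lab (iterate f x (m + 2))                            ∎
    where open ≡-Reasoning

  closed-charge≤6 : ∀ {m x} → 2 ≤ m → iter m f x ≡ x → FaceBound (map lab (iterate f x m)) →
    ∑ chargeAfter (iterate f x m) ≤ 6
  closed-charge≤6 {m} {x} 2≤m period bound = begin
    ∑ chargeAfter (iterate f x m)                ≡⟨ pathCharge-iterate m x ⟨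
    pathCharge (map lab (iterate f x (2 + m)))   ≡⟨ cong (λ k → pathCharge (map lab (iterate f x k))) (+-comm 2 m) ⟩
    pathCharge (map lab (iterate f x (m + 2)))   ≡⟨ cong pathCharge (close-iterate 2≤m period) ⟨
    pathCharge (close (map lab (iterate f x m))) ≤⟨ bound (subst (T ∘ validPath) (sym (close-iterate 2≤m period))
                                                      (validPath-iterate (m + 2) x)) ⟩
    6                                            ∎
    where open ≤-Reasoning

  pentagon-charge≤6 : ∀ {x} → iter 5 f x ≡ x → ∑ chargeAfter (iterate f x 5) ≤ 6
  pentagon-charge≤6 {x} period =
    closed-charge≤6 {5} (s≤s (s≤s z≤n)) period (pentagonTable (lab x) (lab x₁) (lab x₂) (lab x₃) (lab (f x₃)))
    where x₁ = f x; x₂ = f x₁; x₃ = f x₂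

  hexagon-charge≤6 : ∀ {x} → iter 6 f x ≡ x → ∑ chargeAfter (iterate f x 6) ≤ 6
  hexagon-charge≤6 {x} period =
    closed-charge≤6 {6} (s≤s (s≤s z≤n)) period (hexagonTable (lab x) (lab x₁) (lab x₂) (lab x₃) (lab x₄) (lab (f x₄)))
    where x₁ = f x; x₂ = f x₁; x₃ = f x₂; x₄ = f x₃

module Mates {n : ℕ} (G : Cubic n) (M : List (Edge G)) (isMaximal : IsMaximalMatching G M) where

  Joins : Edge G → Fin n → Fin n → Set
  Joins (a , b) u v = (a ≡ u × b ≡ v) ⊎ (a ≡ v × b ≡ u)

  MatchedTo : Fin n → Fin n → Set
  MatchedTo u v = Any (λ e → Joins e u v) M

  matchedTo? : ∀ u v → Dec (MatchedTo u v)
  matchedTo? u v = any? (λ (a , b) → ((a ≟ u) ×-dec (b ≟ v)) ⊎-dec ((a ≟ v) ×-dec (b ≟ u))) M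

  -- the position, in the rotation at v, of the edge of M at v
  mate : Fin n → Maybe (Fin 3)
  mate v with anyFin? (λ i → matchedTo? v (nbr G v i))
  ... | yes (i , _) = just i
  ... | no _ = nothing

  MatchedTo-sym : ∀ {u v} → MatchedTo u v → MatchedTo v u
  MatchedTo-sym = Any.map Sum.swap

  MatchedTo⇒Covered : ∀ {u v} → MatchedTo u v → Covered G M u
  MatchedTo⇒Covered = Any.map (Sum.map proj₁ proj₂)

  MatchedTo-unique : ∀ {u v v′} → MatchedTo u v → MatchedTo u v′ → v ≡ v′
  MatchedTo-unique = go (proj₂ (proj₁ isMaximal))
    where
    ends-meet : ∀ {e f u} → Disjoint G e f → (proj₁ e ≡ u ⊎ proj₂ e ≡ u) → (proj₁ f ≡ u ⊎ proj₂ f ≡ u) → ⊥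
    ends-meet (d₁₁ , d₁₂ , d₂₁ , d₂₂) (inj₁ x) (inj₁ y) = d₁₁ (trans x (sym y))
    ends-meet (d₁₁ , d₁₂ , d₂₁ , d₂₂) (inj₁ x) (inj₂ y) = d₁₂ (trans x (sym y))
    ends-meet (d₁₁ , d₁₂ , d₂₁ , d₂₂) (inj₂ x) (inj₁ y) = d₂₁ (trans x (sym y))
    ends-meet (d₁₁ , d₁₂ , d₂₁ , d₂₂) (inj₂ x) (inj₂ y) = d₂₂ (trans x (sym y))
    other-end : ∀ {e u v v′} → Joins e u v → Joins e u v′ → v ≡ v′
    other-end (inj₁ (_ , q)) (inj₁ (_ , q′)) = trans (sym q) q′
    other-end (inj₁ (p , q)) (inj₂ (p′ , q′)) = trans (sym q) (trans q′ (trans (sym p) p′))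
    other-end (inj₂ (p , q)) (inj₁ (p′ , q′)) = trans (sym p) (trans p′ (trans (sym q) q′))
    other-end (inj₂ (p , _)) (inj₂ (p′ , _)) = trans (sym p) p′
    unmatched : ∀ {e u v es} → All (Disjoint G e) es → (proj₁ e ≡ u ⊎ proj₂ e ≡ u) → Any (λ f → Joins f u v) es → ⊥
    unmatched (d ∷ _) end (here j) = ends-meet d end (Sum.map proj₁ proj₂ j)
    unmatched (_ ∷ ds) end (there j) = unmatched ds end j
    go : ∀ {es u v v′} → AllPairs (Disjoint G) es → Any (λ e → Joins e u v) es → Any (λ e → Joins e u v′) es → v ≡ v′
    go (_ ∷ _) (here j) (here j′) = other-end j j′
    go (ds ∷ _) (here j) (there j′) = ⊥-elim (unmatched ds (Sum.map proj₁ proj₂ j) j′)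
    go (ds ∷ _) (there j) (here j′) = ⊥-elim (unmatched ds (Sum.map proj₁ proj₂ j′) j)
    go (_ ∷ pairs) (there j) (there j′) = go pairs j j′

  Covered⇒MatchedTo : ∀ {u} → Covered G M u → ∃ λ i → MatchedTo u (nbr G u i)
  Covered⇒MatchedTo = go (proj₁ (proj₁ isMaximal))
    where
    go : ∀ {es u} → All (λ e → Adj G (proj₁ e) (proj₂ e)) es → Any (λ e → proj₁ e ≡ u ⊎ proj₂ e ≡ u) es →
         ∃ λ i → Any (λ e → Joins e u (nbr G u i)) es
    go ((i , refl) ∷ _) (here (inj₁ refl)) = i , here (inj₁ (refl , refl))
    go ((i , refl) ∷ _) (here (inj₂ refl)) = back G _ i , here (inj₂ (sym (back-ok G _ i) , refl))
    go (_ ∷ adj) (there c) with go adj c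
    ... | i , j = i , there j

  mate≡just⇔ : ∀ v i → mate v ≡ just i ⇔ MatchedTo v (nbr G v i)
  mate≡just⇔ v i with anyFin? (λ i → matchedTo? v (nbr G v i))
  ... | yes (i′ , m′) = mk⇔ (λ { refl → m′ }) λ m → cong just (nbr-inj G v i′ i (MatchedTo-unique m′ m))
  ... | no ¬m = mk⇔ (λ ()) λ m → ⊥-elim (¬m (i , m))

  mate-reverse : ∀ v i → mate v ≡ just i → mate (nbr G v i) ≡ just (back G v i)
  mate-reverse v i mated = Equivalence.from (mate≡just⇔ _ _)
    (subst (MatchedTo (nbr G v i)) (sym (back-ok G v i)) (MatchedTo-sym (Equivalence.to (mate≡just⇔ v i) mated)))

  mate≡nothing⇒uncovered : ∀ v → mate v ≡ nothing → ¬ Covered G M v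
  mate≡nothing⇒uncovered v unmated covered with Covered⇒MatchedTo covered
  ... | i , m with () ← trans (sym (Equivalence.from (mate≡just⇔ v i) m)) unmated

  mate-maximal : ∀ v i → mate v ≡ nothing → mate (nbr G v i) ≡ nothing → ⊥
  mate-maximal v i unmated unmated′ with proj₂ isMaximal v (nbr G v i) (i , refl)
  ... | inj₁ covered = mate≡nothing⇒uncovered v unmated covered
  ... | inj₂ covered = mate≡nothing⇒uncovered (nbr G v i) unmated′ covered

  -- every edge of M has two ends
  matched-count : ∑ (λ v → 𝟙 (is-just (mate v))) (allFin n) ≤ 2 * length M
  matched-count = begin
    ∑ (λ v → 𝟙 (is-just (mate v))) V ≤⟨ ∑-mono-≤ matched≤ends V ⟩
    ∑ (λ v → ∑ (λ e → ends e v) M) V ≡⟨ ∑-swap (λ v e → ends e v) V M ⟩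
    ∑ (λ e → ∑ (ends e) V) M         ≤⟨ ∑-mono-≤ ends-total M ⟩
    ∑ (λ _ → 2) M                    ≡⟨ ∑-const 2 M ⟩
    2 * length M                     ∎
    where
    open ≤-Reasoning
    V = allFin n
    ends : Edge G → Fin n → ℕ
    ends (a , b) v = 𝟙 (does (a ≟ v)) + 𝟙 (does (b ≟ v))
    ends-total : ∀ e → ∑ (ends e) V ≤ 2
    ends-total (a , b) = ≤-trans (≤-reflexive (∑-+ _ _ V))
      (+-mono-≤ (∑-𝟙-≟ a (Unique.allFin⁺ n)) (∑-𝟙-≟ b (Unique.allFin⁺ n)))
    matched≤ends : ∀ v → 𝟙 (is-just (mate v)) ≤ ∑ (λ e → ends e v) M
    matched≤ends v with mate v in mated
    ... | nothing = z≤n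
    ... | just i with find (MatchedTo⇒Covered (Equivalence.to (mate≡just⇔ v i) mated))
    ...   | (a , b) , e∈M , end = ≤-trans (at-end end) (∈⇒≤∑ (λ e → ends e v) e∈M)
      where
      at-end : a ≡ v ⊎ b ≡ v → 1 ≤ ends (a , b) v
      at-end (inj₁ refl) rewrite dec-true (a ≟ a) refl = s≤s z≤n
      at-end (inj₂ refl) rewrite dec-true (b ≟ b) refl = m≤n+m 1 _

module Discharging {n : ℕ} (G : Cubic n) (pentHex : PentHexFaces G) (mate : Fin n → Maybe (Fin 3))
  (mate-reverse : ∀ v i → mate v ≡ just i → mate (nbr G v i) ≡ just (back G v i))
  (mate-maximal : ∀ v i → mate v ≡ nothing → mate (nbr G v i) ≡ nothing → ⊥) where

  open Darts G

  cornerLabel : Dart n → Label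
  cornerLabel (v , i) = label (mate v) i

  Mated : Dart n → Set
  Mated (v , i) = mate v ≡ just i

  Mated-reverse : ∀ d → Mated d ⇔ Mated (reverse d)
  Mated-reverse (v , i) = mk⇔ (mate-reverse v i) λ mated → subst Mated (reverse-involutive (v , i)) (mate-reverse _ _ mated)

  cornerLabel-φ : ∀ d → cornerLabel (φ d) ≡ turn (cornerLabel (reverse d))
  cornerLabel-φ (v , i) = label-next3 (mate (nbr G v i)) (back G v i)

  valid-corners : ∀ d → T (valid (cornerLabel d) (cornerLabel (φ d)))
  valid-corners d@(v , i) = subst (T ∘ valid (cornerLabel d)) (sym (cornerLabel-φ d))
    (valid-turn (cornerLabel d) (cornerLabel (reverse d)) bothN bothU)
    where
    bothN : cornerLabel d ≡ N ⇔ cornerLabel (reverse d) ≡ N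
    bothN = ⇔.trans (label≡N⇔ (mate v) i) (⇔.trans (Mated-reverse d) (⇔.sym (label≡N⇔ _ _)))
    bothU : ¬ (cornerLabel d ≡ U × cornerLabel (reverse d) ≡ U)
    bothU (U₁ , U₂) = mate-maximal v i (label≡U⇒nothing _ _ U₁) (label≡U⇒nothing _ _ U₂)

  open LabelledOrbit φ cornerLabel valid-corners

  faceSize : Dart n → ℕ
  faceSize d with pentHex d
  ... | inj₁ _ = 5
  ... | inj₂ _ = 6

  isFaceSize : ∀ d → FaceSize G d (faceSize d)
  isFaceSize d with pentHex d
  ... | inj₁ pentagon = pentagon
  ... | inj₂ hexagon = hexagon

  faceSize-positive : ∀ d → 0 < faceSize d
  faceSize-positive d with pentHex d
  ... | inj₁ _ = s≤s z≤n
  ... | inj₂ _ = s≤s z≤n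

  faceSize≤6 : ∀ d → faceSize d ≤ 6
  faceSize≤6 d with pentHex d
  ... | inj₁ _ = n≤1+n 5
  ... | inj₂ _ = ≤-refl

  open FaceCounting G faceSize faceSize-positive isFaceSize 6 faceSize≤6

  face-charge≤6 : ∀ r → ∑ chargeAfter (iterate φ r (faceSize r)) ≤ 6
  face-charge≤6 r with pentHex r
  ... | inj₁ (period , _) = pentagon-charge≤6 period
  ... | inj₂ (period , _) = hexagon-charge≤6 period

  -- the charge the corner d receives; chargeAfter d is the charge of the corner after d
  chargeAt : Dart n → ℕ
  chargeAt d = charge (cornerLabel (φ⁻¹ d)) (cornerLabel d) (cornerLabel (φ d))

  chargeAt-φ : ∀ d → chargeAt (φ d) ≡ chargeAfter d
  chargeAt-φ d = cong (λ c → charge (cornerLabel c) (cornerLabel (φ d)) (cornerLabel (φ (φ d)))) (φ⁻¹-φ d)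

  vertex-demand : ∀ v → demand (label (mate v) fz) ≤ ∑ (λ i → chargeAt (v , i)) (allFin 3)
  vertex-demand v = subst (demand ℓ ≤_) (sym charges) (vertexTable ℓ (t fz) (t (fs fz)) (t (fs (fs fz)))
    (subst (T ∘ valid (t fz)) own₁ (valid-at fz)) (subst (T ∘ valid (t (fs fz))) own₂ (valid-at (fs fz))) (valid-at (fs (fs fz))))
    where
    ℓ = cornerLabel (v , fz)
    t : Fin 3 → Label
    t i = cornerLabel (reverse (v , i))
    own₁ : cornerLabel (v , fs fz) ≡ turn ℓ
    own₁ = label-next3 (mate v) fz
    own₂ : cornerLabel (v , fs (fs fz)) ≡ turn (turn ℓ)
    own₂ = trans (label-next3 (mate v) (fs fz)) (cong turn own₁)
    valid-at : ∀ i → T (valid (t i) (cornerLabel (v , next3 i)))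
    valid-at i = subst (T ∘ valid (t i) ∘ cornerLabel) (φ-reverse (v , i)) (valid-corners (reverse (v , i)))
    corner₀ = charge (t (fs (fs fz))) ℓ (turn (t fz))
    corner₁ = charge (t fz) (turn ℓ) (turn (t (fs fz)))
    corner₂ = charge (t (fs fz)) (turn (turn ℓ)) (turn (t (fs (fs fz))))
    charges : ∑ (λ i → chargeAt (v , i)) (allFin 3) ≡ corner₀ + (corner₁ + corner₂)
    charges rewrite cornerLabel-φ (v , fz) | cornerLabel-φ (v , fs fz) | cornerLabel-φ (v , fs (fs fz)) | own₁ | own₂ =
      cong (λ c → corner₀ + (corner₁ + c)) (+-identityʳ corner₂)

  discharge : ∑ (λ v → demand (label (mate v) fz)) (allFin n) ≤ 6 * faceCount G
  discharge = begin
    ∑ (λ v → demand (label (mate v) fz)) (allFin n)             ≤⟨ ∑-mono-≤ vertex-demand (allFin n) ⟩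
    ∑ (λ v → ∑ (λ i → chargeAt (v , i)) (allFin 3)) (allFin n) ≡⟨ ∑-cartesianProduct chargeAt (allFin n) (allFin 3) ⟨
    ∑ chargeAt (allDarts G)                                   ≡⟨ ∑-φ chargeAt ⟨
    ∑ (chargeAt ∘ φ) (allDarts G)                             ≡⟨ ∑-cong chargeAt-φ (allDarts G) ⟩
    ∑ chargeAfter (allDarts G)                                ≤⟨ ∑-≤-faceCount chargeAfter 6 (λ r _ → face-charge≤6 r) ⟩
    6 * faceCount G                                           ∎
    where open ≤-Reasoning

demand+3*matched : ∀ x → demand (label x fz) + 3 * 𝟙 (is-just x) ≡ 5
demand+3*matched nothing = refl
demand+3*matched (just fz) = refl
demand+3*matched (just (fs fz)) = refl
demand+3*matched (just (fs (fs fz))) = refl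

total-demand : ∀ {n} (mate : Fin n → Maybe (Fin 3)) →
  ∑ (λ v → demand (label (mate v) fz)) (allFin n) + 3 * ∑ (λ v → 𝟙 (is-just (mate v))) (allFin n) ≡ 5 * n
total-demand {n} mate = begin
  ∑ D V + 3 * ∑ C V            ≡⟨ cong (∑ D V +_) (∑-*ˡ 3 C V) ⟨
  ∑ D V + ∑ (λ v → 3 * C v) V  ≡⟨ ∑-+ D (λ v → 3 * C v) V ⟨
  ∑ (λ v → D v + 3 * C v) V    ≡⟨ ∑-cong (demand+3*matched ∘ mate) V ⟩
  ∑ (λ _ → 5) V                ≡⟨ ∑-const 5 V ⟩
  5 * length V                 ≡⟨ cong (5 *_) (length-tabulate {n = n} id) ⟩
  5 * n                        ∎
  where
  open ≡-Reasoning
  V = allFin n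
  D = λ v → demand (label (mate v) fz)
  C = λ v → 𝟙 (is-just (mate v))

euler-arithmetic : ∀ {n F c m D} → 2 * n + 2 * F ≡ 3 * n + 4 → D + 3 * c ≡ 5 * n → D ≤ 6 * F → c ≤ 2 * m →
  n ≤ 3 * m + 6
euler-arithmetic {n} {F} {c} {m} {D} euler total discharged matched = *-cancelˡ-≤ 2 (begin
  2 * n            ≤⟨ +-cancelˡ-≤ (3 * n) _ _ three-n+two-n≤ ⟩
  12 + 3 * c       ≤⟨ +-monoʳ-≤ 12 (*-monoʳ-≤ 3 matched) ⟩
  12 + 3 * (2 * m) ≡⟨ solve (m List.∷ List.[]) ⟩
  2 * (3 * m + 6)  ∎)
  where
  open ≤-Reasoning
  two-F : 2 * F ≡ n + 4
  two-F = +-cancelˡ-≡ (2 * n) _ _ (trans euler (solve (n List.∷ List.[])))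
  three-n+two-n≤ : 3 * n + 2 * n ≤ 3 * n + (12 + 3 * c)
  three-n+two-n≤ = begin
    3 * n + 2 * n         ≡⟨ solve (n List.∷ List.[]) ⟩
    5 * n                 ≡⟨ total ⟨
    D + 3 * c             ≤⟨ +-monoˡ-≤ (3 * c) discharged ⟩
    6 * F + 3 * c         ≡⟨ solve (F List.∷ c List.∷ List.[]) ⟩
    3 * (2 * F) + 3 * c   ≡⟨ cong (λ x → 3 * x + 3 * c) two-F ⟩
    3 * (n + 4) + 3 * c   ≡⟨ solve (n List.∷ c List.∷ List.[]) ⟩
    3 * n + (12 + 3 * c)  ∎

mainTheorem3 : (n : ℕ) (G : Cubic n) → Fullerene G →
    (M : List (Edge G)) → IsMaximalMatching G M →
    n ≤ 3 * length M + 6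
mainTheorem3 n G (_ , (_ , euler) , pentHex) M isMaximal =
  euler-arithmetic {F = faceCount G} {m = length M} euler (total-demand mate) discharge matched-count
  where
  open Mates G M isMaximal
  open Discharging G pentHex mate mate-reverse mate-maximal
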